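{- Let $G$ be a graph and $R\subseteq V(G)$ with $|R|\ge 2$. A set of trees is an $R$-CIST of $G$ if and only if it is an $R$-CIST of some graph $\mathrm{simp}(G,R)$.
   Context: Graphs are finite and connected, may have parallel edges but no loops. For a tree $T$, $\mathrm{int}(T)$ is the set of vertices of degree at least 2 in $T$ and $L(T)$ the set of leaves. An $R$-Steiner tree is a subtree $T$ of $G$ with $R\subseteq V(T)$ and $L(T)\subseteq R$; $T(u,v)$ is the unique $(u,v)$-path in $T$. An $R$-CIST of $G$ is a set $\{T_1,\dots,T_k\}$ of $R$-Steiner trees such that for every pair of distinct $u,v\in R$ and all distinct $i,j$, the paths $T_i(u,v)$ and $T_j(u,v)$ are edge-disjoint and internally vertex-disjoint. A graph $\mathrm{simp}(G,R)$ is any subgraph of $G$ (on the same vertex set) obtained as follows: for every pair of vertices $\{u,v\}$ joined by more than one edge in $G$: (1) if $\{u,v\}\subseteq R$ and $|R|\ge 3$, delete all edges between $u$ and $v$ except two of them; (2) otherwise, if $u\notin R$ or $v\notin R$, delete all edges between $u$ and $v$ except one of them. (If $R=\{u,v\}$, all parallel edges between $u$ and $v$ are kept.) Since parallel edges are distinguishable, $\mathrm{simp}(G,R)$ need not be unique. -}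

module Defs where

open import Data.Nat using (ℕ; zero; suc; _≤_; _<_)
open import Data.Fin using (Fin)
open import Data.Fin.Properties using (_≟_)
open import Data.Fin.Subset as S using (Subset; ∣_∣; _∩_; _⊆_)
open import Data.Bool using (Bool; _∨_; _∧_)
open import Data.Vec using (tabulate)
open import Data.List using (List; []; _∷_; length)
open import Data.List.Membership.Propositional as L using ()
open import Data.List.Relation.Unary.Unique.Propositional using (Unique)
open import Data.Product using (_×_; _,_; proj₁; proj₂; Σ; ∃; ∃-syntax)
open import Data.Sum using (_⊎_)
open import Data.Empty using (⊥)
open import Relation.Nullary using (¬_; does)
open import Relation.Binary.PropositionalEquality using (_≡_; _≢_)

-- Finite multigraphs: vertices Fin n, edges Fin m (edges are distinguishable,
-- parallel edges allowed), each edge has two distinct endpoints (no loops).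

Joins : {n m : ℕ} → (Fin m → Fin n × Fin n) → Fin m → Fin n → Fin n → Set
Joins ends e u w = (ends e ≡ (u , w)) ⊎ (ends e ≡ (w , u))

data Walk {n m : ℕ} (ends : Fin m → Fin n × Fin n) (A : Subset m)
          : Fin n → Fin n → Set where
  []   : ∀ {u} → Walk ends A u u
  step : ∀ {u w v} (e : Fin m) → e S.∈ A → Joins ends e u w →
         Walk ends A w v → Walk ends A u v

module _ {n m : ℕ} {ends : Fin m → Fin n × Fin n} {A : Subset m} where

  verts : ∀ {u v} → Walk ends A u v → List (Fin n)
  verts {u} []             = u ∷ []
  verts {u} (step _ _ _ p) = u ∷ verts p

  edges : ∀ {u v} → Walk ends A u v → List (Fin m)
  edges []             = []
  edges (step e _ _ p) = e ∷ edges p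

  IsPath : ∀ {u v} → Walk ends A u v → Set
  IsPath p = Unique (verts p)

record Graph : Set where
  field
    n      : ℕ
    m      : ℕ
    ends   : Fin m → Fin n × Fin n
    noLoop : ∀ e → proj₁ (ends e) ≢ proj₂ (ends e)
    conn   : ∀ u v → Walk ends S.⊤ u v

module _ (G : Graph) where
  open Graph G

  record Sub : Set where
    constructor sub
    field
      V : Subset n
      E : Subset m

  incident : Fin n → Subset m
  incident v = tabulate (λ e → does (proj₁ (ends e) ≟ v) ∨ does (proj₂ (ends e) ≟ v))

  joinSet : Fin n → Fin n → Subset m
  joinSet u v = tabulate (λ e →
    (does (proj₁ (ends e) ≟ u) ∧ does (proj₂ (ends e) ≟ v)) ∨
    (does (proj₁ (ends e) ≟ v) ∧ does (proj₂ (ends e) ≟ u)))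

  deg : Sub → Fin n → ℕ
  deg T v = ∣ Sub.E T ∩ incident v ∣

  HasCycle : Subset m → Set
  HasCycle E = Σ (Fin n) λ u → Σ (Fin n) λ v → Σ (Walk ends E u v) λ p →
    IsPath p × (1 ≤ length (edges p)) ×
    Σ (Fin m) λ e → e S.∈ E × Joins ends e v u × ¬ (e L.∈ edges p)

  IsTree : Sub → Set
  IsTree (sub V E) =
    (∀ e → e S.∈ E → proj₁ (ends e) S.∈ V × proj₂ (ends e) S.∈ V) ×
    (∃[ x ] x S.∈ V) ×
    (∀ u v → u S.∈ V → v S.∈ V → Walk ends E u v) ×
    ¬ HasCycle E

  IsLeaf : Sub → Fin n → Set
  IsLeaf T v = v S.∈ Sub.V T × deg T v ≡ 1

  -- R-Steiner tree of the spanning subgraph of G with edge set H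
  IsSteinerTree : Subset m → Subset n → Sub → Set
  IsSteinerTree H R T =
    IsTree T × Sub.E T ⊆ H × R ⊆ Sub.V T × (∀ v → IsLeaf T v → v S.∈ R)

  Independent : ∀ {E₁ E₂ u v} → Walk ends E₁ u v → Walk ends E₂ u v → Set
  Independent {u = u} {v} P Q =
    (∀ e → e L.∈ edges P → e L.∈ edges Q → ⊥) ×
    (∀ x → x L.∈ verts P → x L.∈ verts Q → (x ≡ u) ⊎ (x ≡ v))

  -- T(u,v) is the unique (u,v)-path in T; we quantify over all
  -- (u,v)-paths in T (there is exactly one since T is a tree).
  IsCIST : Subset m → Subset n → (k : ℕ) → (Fin k → Sub) → Set
  IsCIST H R k T =
    (∀ i → IsSteinerTree H R (T i)) ×
    (∀ u v → u S.∈ R → v S.∈ R → u ≢ v → ∀ i j → i ≢ j →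
      (P : Walk ends (Sub.E (T i)) u v) → IsPath P →
      (Q : Walk ends (Sub.E (T j)) u v) → IsPath Q →
      Independent P Q)

  -- S ⊆ E(G) is the edge set of some simp(G,R)
  mult : Fin n → Fin n → ℕ
  mult u v = ∣ joinSet u v ∣

  kept : Subset m → Fin n → Fin n → ℕ
  kept S u v = ∣ S ∩ joinSet u v ∣

  IsSimp : Subset n → Subset m → Set
  IsSimp R S = ∀ u v → u ≢ v →
    (mult u v ≤ 1 → kept S u v ≡ mult u v) ×
    (1 < mult u v → u S.∈ R → v S.∈ R → 3 ≤ ∣ R ∣ → kept S u v ≡ 2) ×
    (1 < mult u v → (¬ (u S.∈ R) ⊎ ¬ (v S.∈ R)) → kept S u v ≡ 1) ×
    (1 < mult u v → u S.∈ R → v S.∈ R → ∣ R ∣ ≡ 2 → kept S u v ≡ mult u v)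

{-# OPTIONS --safe #-}
-- Let U be the set of edges used by the trees of an R-CIST {Tᵢ}. Two parallel edges of U never lie
-- in one tree. Let e₁ ∈ Tᵢ and e₂ ∈ Tⱼ join a and b, with a ∉ R. Since all leaves are terminals, there
-- are terminals x, y on the two sides of e₁ in Tᵢ. If e₂ separates them in Tⱼ too, then Tᵢ(x,y) and
-- Tⱼ(x,y) share the inner vertex a; otherwise a terminal beyond e₂ forms such a pair with x or y.
-- If a, b ∈ R and three trees contain an edge ab, a third terminal w lies on the same side of that
-- edge in two of them, and both their paths from w to b pass through a. So U has at most one edge
-- between a and b unless a, b ∈ R, and at most two if moreover |R| ≥ 3; hence some simp(G,R)
-- contains U and carries the same CIST. The converse holds because the CIST conditions only ask
-- the host edge set to contain the trees.
module Submission where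

open import Defs
open import Data.Nat using (ℕ; _≤_)
open import Data.Fin using (Fin)
open import Data.Fin.Subset using (Subset; ∣_∣; ⊤)
open import Data.Product using (Σ; _×_)
open import Function.Bundles using (_⇔_)

open import Data.Bool.Properties using (∨-comm)
open import Data.Empty using (⊥)
open import Data.Fin using (zero; suc)
open import Data.Fin.Properties using (_≟_; any?)
open import Data.Fin.Subset as S using (_∩_; _-_; ⁅_⁆; Nonempty; inside; outside)
open import Data.Fin.Subset.Properties
  using (_∈?_; ∈⊤; ∣⊤∣≡n; ∣⊥∣≡0; Empty-unique; nonempty?; s⊆s; out⊆; drop-∷-⊆; ⊆-antisym; p⊆q⇒∣p∣≤∣q∣;
         p∩q⊆q; x∈p∩q⁺; x∈p∩q⁻; ∣p∩q∣≤∣q∣; p─q⊆p; p─⊥≡p; x∈p⇒∣p-x∣<∣p∣; x∈p∧x≢y⇒x∈p-y)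
open import Data.List as List using (List; []; _∷_; _++_; length; reverse)
open import Data.List.Membership.Propositional using () renaming (_∈_ to _∈ˡ_)
open import Data.List.Properties using (unfold-reverse; reverse-++)
open import Data.List.Relation.Unary.All as All using ()
open import Data.List.Relation.Unary.AllPairs using ([]; _∷_)
open import Data.List.Relation.Unary.Any using (here; there)
open import Data.List.Relation.Unary.Linked as Linked using (Linked; []; [-]; _∷_)
open import Data.List.Relation.Unary.Unique.Propositional using (Unique)
open import Data.Nat using (zero; suc; _+_; _∸_; _<_; z≤n; s≤s; s≤s⁻¹)
open import Data.Nat.Properties
  using (≤-refl; ≤-trans; ≤-reflexive; <⇒≤; <⇒≱; >⇒≢; ≰⇒>; ≤∧≢⇒<; 1+n≰n; n≤1+n; n≤0⇒n≡0; _≤?_;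
         m+[n∸m]≡n; +-suc; +-identityʳ)
  renaming (_≟_ to _≟ℕ_)
open import Data.Product as Prod using (_,_; proj₁; proj₂; ∃-syntax)
open import Data.Product.Properties using (,-injective)
open import Data.Sum as Sum using (_⊎_; inj₁; inj₂)
open import Data.Vec as Vec using ([]; _∷_; tabulate)
open import Data.Vec.Properties using (tabulate-cong; lookup∘tabulate; lookup⇒[]=; []=⇒lookup)
open import Function using (_∘_; id)
open import Function.Bundles using (mk⇔)
open import Level using (0ℓ)
open import Relation.Binary.Core using (Rel)
open import Relation.Binary.Definitions using (Symmetric)
open import Relation.Binary.PropositionalEquality
  using (_≡_; _≢_; refl; sym; trans; cong; cong₂; subst; ≢-sym; module ≡-Reasoning)
open import Relation.Nullary using (¬_; Dec; yes; no; does; proof; contradiction; _×-dec_; _⊎-dec_)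
open import Relation.Nullary.Decidable using (dec-true)
open import Relation.Nullary.Reflects using (Reflects; invert)
open import Relation.Unary using (Decidable)

module _ {k : ℕ} {P : Fin k → Set} (P? : Decidable P) where

  ∈-decided⁺ : ∀ {x} → P x → x S.∈ tabulate (does ∘ P?)
  ∈-decided⁺ {x} px = lookup⇒[]= x _ (trans (lookup∘tabulate _ x) (dec-true (P? x) px))

  ∈-decided⁻ : ∀ {x} → x S.∈ tabulate (does ∘ P?) → P x
  ∈-decided⁻ {x} x∈ =
    invert (subst (Reflects (P x)) (trans (sym (lookup∘tabulate _ x)) ([]=⇒lookup x∈)) (proof (P? x)))

∣p∣>0⇒Nonempty : ∀ {k} {p : Subset k} → 0 < ∣ p ∣ → Nonempty p
∣p∣>0⇒Nonempty {k} {p} ∣p∣>0 with nonempty? p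
... | yes ne = ne
... | no empty = contradiction (subst (0 <_) ∣p∣≡0 ∣p∣>0) λ ()
  where ∣p∣≡0 = trans (cong ∣_∣ (Empty-unique empty)) (∣⊥∣≡0 k)

x∈p-y⇒x≢y : ∀ {k} {p : Subset k} {x y} → x S.∈ p - y → x ≢ y
x∈p-y⇒x≢y {p = _ ∷ _} {zero}  ()             refl
x∈p-y⇒x≢y {p = _ ∷ _} {suc _} (Vec.there x∈) refl = x∈p-y⇒x≢y x∈ refl

∣p∣≤1+∣p-x∣ : ∀ {k} (p : Subset k) x → ∣ p ∣ ≤ suc ∣ p - x ∣
∣p∣≤1+∣p-x∣ (inside  ∷ p) zero    = s≤s (≤-reflexive (sym (cong ∣_∣ (p─⊥≡p p))))
∣p∣≤1+∣p-x∣ (outside ∷ p) zero    = ≤-trans (n≤1+n _) (s≤s (≤-reflexive (sym (cong ∣_∣ (p─⊥≡p p)))))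
∣p∣≤1+∣p-x∣ (inside  ∷ p) (suc x) = s≤s (∣p∣≤1+∣p-x∣ p x)
∣p∣≤1+∣p-x∣ (outside ∷ p) (suc x) = ∣p∣≤1+∣p-x∣ p x

∃-∈-≢ : ∀ {k} {p : Subset k} x → 2 ≤ ∣ p ∣ → ∃[ y ] y S.∈ p × y ≢ x
∃-∈-≢ {p = p} x 2≤∣p∣ with ∣p∣>0⇒Nonempty {p = p - x} (s≤s⁻¹ (≤-trans 2≤∣p∣ (∣p∣≤1+∣p-x∣ p x)))
... | y , y∈p-x = y , p─q⊆p p ⁅ x ⁆ y∈p-x , x∈p-y⇒x≢y y∈p-x

∃-∈-≢₂ : ∀ {k} {p : Subset k} x x′ → 3 ≤ ∣ p ∣ → ∃[ y ] y S.∈ p × y ≢ x × y ≢ x′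
∃-∈-≢₂ {p = p} x x′ 3≤∣p∣ with ∃-∈-≢ {p = p - x} x′ (s≤s⁻¹ (≤-trans 3≤∣p∣ (∣p∣≤1+∣p-x∣ p x)))
... | y , y∈p-x , y≢x′ = y , p─q⊆p p ⁅ x ⁆ y∈p-x , x∈p-y⇒x≢y y∈p-x , y≢x′

∣p∣≤1 : ∀ {k} {p : Subset k} → (∀ {x y} → x S.∈ p → y S.∈ p → x ≢ y → ⊥) → ∣ p ∣ ≤ 1
∣p∣≤1 {p = p} no-two with ∣ p ∣ ≤? 1
... | yes ∣p∣≤1 = ∣p∣≤1
... | no ∣p∣≰1 with ∣p∣>0⇒Nonempty (≤-trans (s≤s z≤n) (≰⇒> ∣p∣≰1))
... | x , x∈p with ∃-∈-≢ x (≰⇒> ∣p∣≰1)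
... | y , y∈p , y≢x = contradiction y≢x (no-two y∈p x∈p)

∣p∣≤2 : ∀ {k} {p : Subset k} → (∀ {x y z} → x S.∈ p → y S.∈ p → z S.∈ p → x ≢ y → x ≢ z → y ≢ z → ⊥) →
        ∣ p ∣ ≤ 2
∣p∣≤2 {p = p} no-three with ∣ p ∣ ≤? 2
... | yes ∣p∣≤2 = ∣p∣≤2
... | no ∣p∣≰2 with ∣p∣>0⇒Nonempty (≤-trans (s≤s z≤n) (≰⇒> ∣p∣≰2))
... | x , x∈p with ∃-∈-≢ x (≤-trans (n≤1+n 2) (≰⇒> ∣p∣≰2))
... | y , y∈p , y≢x with ∃-∈-≢₂ x y (≰⇒> ∣p∣≰2)
... | z , z∈p , z≢x , z≢y = contradiction y≢x (no-three z∈p y∈p x∈p z≢y z≢x)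

∈∧∣p∣≢1⇒∃-∈-≢ : ∀ {k} {p : Subset k} {x} → x S.∈ p → ∣ p ∣ ≢ 1 → ∃[ y ] y S.∈ p × y ≢ x
∈∧∣p∣≢1⇒∃-∈-≢ {x = x} x∈p ∣p∣≢1 = ∃-∈-≢ x (≤∧≢⇒< (≤-trans (s≤s z≤n) (x∈p⇒∣p-x∣<∣p∣ x∈p)) (≢-sym ∣p∣≢1))

Unique⇒length≤∣p∣ : ∀ {k} {xs : List (Fin k)} {p} → Unique xs → (∀ {x} → x ∈ˡ xs → x S.∈ p) →
                    length xs ≤ ∣ p ∣
Unique⇒length≤∣p∣ [] _ = z≤n
Unique⇒length≤∣p∣ {xs = x ∷ xs} {p} (x∉xs ∷ xs!) xs⊆p =
  ≤-trans (s≤s (Unique⇒length≤∣p∣ xs! xs⊆p-x)) (x∈p⇒∣p-x∣<∣p∣ (xs⊆p (here refl)))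
  where
  xs⊆p-x : ∀ {y} → y ∈ˡ xs → y S.∈ p - x
  xs⊆p-x y∈xs = x∈p∧x≢y⇒x∈p-y (xs⊆p (there y∈xs)) (≢-sym (All.lookup x∉xs y∈xs))

Unique⇒length≤ : ∀ {k} {xs : List (Fin k)} → Unique xs → length xs ≤ k
Unique⇒length≤ {k} xs! = ≤-trans (Unique⇒length≤∣p∣ xs! (λ _ → ∈⊤)) (≤-reflexive (∣⊤∣≡n k))

fill : ∀ {k} → ℕ → Subset k → Subset k → Subset k
fill d       []            []            = []
fill d       (inside  ∷ A) (_ ∷ B)       = inside ∷ fill d A B
fill zero    (outside ∷ A) (_ ∷ B)       = outside ∷ fill zero A B
fill (suc d) (outside ∷ A) (inside  ∷ B) = inside ∷ fill d A B
fill (suc d) (outside ∷ A) (outside ∷ B) = outside ∷ fill (suc d) A B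

⊆-fill : ∀ {k} d (A B : Subset k) → A S.⊆ fill d A B
⊆-fill d       []            []            = id
⊆-fill d       (inside  ∷ A) (_ ∷ B)       = s⊆s (⊆-fill d A B)
⊆-fill zero    (outside ∷ A) (_ ∷ B)       = s⊆s (⊆-fill zero A B)
⊆-fill (suc d) (outside ∷ A) (inside  ∷ B) = out⊆ (⊆-fill d A B)
⊆-fill (suc d) (outside ∷ A) (outside ∷ B) = s⊆s (⊆-fill (suc d) A B)

fill-⊆ : ∀ {k} d {A B : Subset k} → A S.⊆ B → fill d A B S.⊆ B
fill-⊆ d       {[]}          {[]}          _   = id
fill-⊆ d       {inside  ∷ A} {inside  ∷ B} A⊆B = s⊆s (fill-⊆ d (drop-∷-⊆ A⊆B))
fill-⊆ d       {inside  ∷ A} {outside ∷ B} A⊆B = contradiction (A⊆B Vec.here) λ ()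
fill-⊆ zero    {outside ∷ A} {_ ∷ B}       A⊆B = out⊆ (fill-⊆ zero (drop-∷-⊆ A⊆B))
fill-⊆ (suc d) {outside ∷ A} {inside  ∷ B} A⊆B = s⊆s (fill-⊆ d (drop-∷-⊆ A⊆B))
fill-⊆ (suc d) {outside ∷ A} {outside ∷ B} A⊆B = s⊆s (fill-⊆ (suc d) (drop-∷-⊆ A⊆B))

∣fill∣ : ∀ {k} d {A B : Subset k} → A S.⊆ B → ∣ A ∣ + d ≤ ∣ B ∣ → ∣ fill d A B ∣ ≡ ∣ A ∣ + d
∣fill∣ d       {[]}          {[]}          _   ≤0 = sym (n≤0⇒n≡0 ≤0)
∣fill∣ d       {inside  ∷ A} {inside  ∷ B} A⊆B ≤∣B∣ = cong suc (∣fill∣ d (drop-∷-⊆ A⊆B) (s≤s⁻¹ ≤∣B∣))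
∣fill∣ d       {inside  ∷ A} {outside ∷ B} A⊆B _ = contradiction (A⊆B Vec.here) λ ()
∣fill∣ zero    {outside ∷ A} {_ ∷ B}       A⊆B _ =
  ∣fill∣ zero (drop-∷-⊆ A⊆B) (≤-trans (≤-reflexive (+-identityʳ _)) (p⊆q⇒∣p∣≤∣q∣ (drop-∷-⊆ A⊆B)))
∣fill∣ (suc d) {outside ∷ A} {inside  ∷ B} A⊆B ≤∣B∣ =
  trans (cong suc (∣fill∣ d (drop-∷-⊆ A⊆B) (s≤s⁻¹ (≤-trans (≤-reflexive (sym (+-suc ∣ A ∣ d))) ≤∣B∣))))
        (sym (+-suc ∣ A ∣ d))
∣fill∣ (suc d) {outside ∷ A} {outside ∷ B} A⊆B ≤∣B∣ = ∣fill∣ (suc d) (drop-∷-⊆ A⊆B) ≤∣B∣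

module _ {A : Set} {_∼_ : Rel A 0ℓ} where

  Linked-++⁻ˡ : ∀ xs {ys} → Linked _∼_ (xs ++ ys) → Linked _∼_ xs
  Linked-++⁻ˡ []           _        = []
  Linked-++⁻ˡ (x ∷ [])     _        = [-]
  Linked-++⁻ˡ (x ∷ y ∷ xs) (r ∷ rs) = r ∷ Linked-++⁻ˡ (y ∷ xs) rs

  Linked-++-meet : ∀ xs {x ys} → Linked _∼_ (xs ++ x ∷ []) → Linked _∼_ (x ∷ ys) → Linked _∼_ (xs ++ x ∷ ys)
  Linked-++-meet []           _        rs′ = rs′
  Linked-++-meet (_ ∷ [])     (r ∷ _)  rs′ = r ∷ rs′
  Linked-++-meet (_ ∷ y ∷ xs) (r ∷ rs) rs′ = r ∷ Linked-++-meet (y ∷ xs) rs rs′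

  module _ (∼-sym : Symmetric _∼_) where

    Linked-reverseAcc : ∀ {x} xs acc → Linked _∼_ (x ∷ xs) → Linked _∼_ (x ∷ acc) →
                        Linked _∼_ (List.reverseAcc (x ∷ acc) xs)
    Linked-reverseAcc []       acc _        racc = racc
    Linked-reverseAcc (y ∷ ys) acc (r ∷ rs) racc = Linked-reverseAcc ys (_ ∷ acc) rs (∼-sym r ∷ racc)

    Linked-reverse : ∀ {xs} → Linked _∼_ xs → Linked _∼_ (reverse xs)
    Linked-reverse {[]}     _  = []
    Linked-reverse {x ∷ xs} rs = Linked-reverseAcc xs [] rs [-]

NonBacktracking : ∀ {m} → List (Fin m) → Set
NonBacktracking = Linked _≢_

module Walks {n m : ℕ} (ends : Fin m → Fin n × Fin n) where

  Joins-sym : ∀ {e u w} → Joins ends e u w → Joins ends e w u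
  Joins-sym = Sum.swap

  Joins-ends : ∀ {e u w u′ w′} → Joins ends e u w → Joins ends e u′ w′ →
               (u ≡ u′ × w ≡ w′) ⊎ (u ≡ w′ × w ≡ u′)
  Joins-ends (inj₁ p) (inj₁ q) = inj₁ (,-injective (trans (sym p) q))
  Joins-ends (inj₁ p) (inj₂ q) = inj₂ (,-injective (trans (sym p) q))
  Joins-ends (inj₂ p) (inj₁ q) = inj₂ (Prod.swap (,-injective (trans (sym p) q)))
  Joins-ends (inj₂ p) (inj₂ q) = inj₁ (Prod.swap (,-injective (trans (sym p) q)))

  Joins-back : ∀ {e x w y} → Joins ends e x w → Joins ends e w y → y ≡ x
  Joins-back j j′ with Joins-ends j j′
  ... | inj₁ (x≡w , w≡y) = sym (trans x≡w w≡y)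
  ... | inj₂ (x≡y , _)   = sym x≡y

  module _ {A : Subset m} where

    _++ʷ_ : ∀ {x y z} → Walk ends A x y → Walk ends A y z → Walk ends A x z
    []               ++ʷ q = q
    step f f∈A j p   ++ʷ q = step f f∈A j (p ++ʷ q)

    reverseʷ : ∀ {x y} → Walk ends A x y → Walk ends A y x
    reverseʷ []             = []
    reverseʷ (step f f∈A j p) = reverseʷ p ++ʷ step f f∈A (Joins-sym j) []

    edges-++ʷ : ∀ {x y z} (p : Walk ends A x y) (q : Walk ends A y z) → edges (p ++ʷ q) ≡ edges p ++ edges q
    edges-++ʷ []               q = refl
    edges-++ʷ (step f _ _ p) q = cong (f ∷_) (edges-++ʷ p q)

    edges-reverseʷ : ∀ {x y} (p : Walk ends A x y) → edges (reverseʷ p) ≡ reverse (edges p)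
    edges-reverseʷ []             = refl
    edges-reverseʷ (step f _ _ p) = begin
      edges (reverseʷ p ++ʷ step f _ _ [])  ≡⟨ edges-++ʷ (reverseʷ p) _ ⟩
      edges (reverseʷ p) ++ f ∷ []          ≡⟨ cong (_++ f ∷ []) (edges-reverseʷ p) ⟩
      reverse (edges p) ++ f ∷ []           ≡⟨ unfold-reverse f (edges p) ⟨
      reverse (f ∷ edges p)                 ∎
      where open ≡-Reasoning

    first∈verts : ∀ {x y} (p : Walk ends A x y) → x ∈ˡ verts p
    first∈verts []             = here refl
    first∈verts (step _ _ _ _) = here refl

    last∈verts : ∀ {x y} (p : Walk ends A x y) → y ∈ˡ verts p
    last∈verts []             = here refl
    last∈verts (step _ _ _ p) = there (last∈verts p)

    ∈-verts-++ʷʳ : ∀ {x y z u} (p : Walk ends A x y) {q : Walk ends A y z} →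
                   u ∈ˡ verts q → u ∈ˡ verts (p ++ʷ q)
    ∈-verts-++ʷʳ []             u∈q = u∈q
    ∈-verts-++ʷʳ (step _ _ _ p) u∈q = there (∈-verts-++ʷʳ p u∈q)

    Joins-∈-verts : ∀ {x y f u w} (p : Walk ends A x y) → Joins ends f u w → f ∈ˡ edges p →
                    u ∈ˡ verts p × w ∈ˡ verts p
    Joins-∈-verts (step f _ j p) j′ (here refl) with Joins-ends j′ j
    ... | inj₁ (refl , refl) = here refl , there (first∈verts p)
    ... | inj₂ (refl , refl) = there (first∈verts p) , here refl
    Joins-∈-verts (step _ _ _ p) j′ (there f∈p) = Prod.map there there (Joins-∈-verts p j′ f∈p)

    prefixʷ : ∀ {x y z} (p : Walk ends A x y) → z ∈ˡ verts p → Walk ends A x z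
    prefixʷ []               (here refl) = []
    prefixʷ (step _ _ _ _)   (here refl) = []
    prefixʷ (step f f∈A j p) (there z∈p) = step f f∈A j (prefixʷ p z∈p)

    verts-prefixʷ⊆ : ∀ {x y z u} (p : Walk ends A x y) (z∈p : z ∈ˡ verts p) →
                     u ∈ˡ verts (prefixʷ p z∈p) → u ∈ˡ verts p
    verts-prefixʷ⊆ []             (here refl) u∈        = u∈
    verts-prefixʷ⊆ (step _ _ _ p) (here refl) (here eq) = here eq
    verts-prefixʷ⊆ (step _ _ _ p) (there z∈p) (here eq) = here eq
    verts-prefixʷ⊆ (step _ _ _ p) (there z∈p) (there u∈) = there (verts-prefixʷ⊆ p z∈p u∈)

    IsPath-prefixʷ : ∀ {x y z} (p : Walk ends A x y) (z∈p : z ∈ˡ verts p) → IsPath p → IsPath (prefixʷ p z∈p)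
    IsPath-prefixʷ []             (here refl) p!        = p!
    IsPath-prefixʷ (step _ _ _ p) (here refl) _         = All.[] ∷ []
    IsPath-prefixʷ (step _ _ _ p) (there z∈p) (x∉p ∷ p!) =
      All.tabulate (All.lookup x∉p ∘ verts-prefixʷ⊆ p z∈p) ∷ IsPath-prefixʷ p z∈p p!

    closed-path : ∀ {x z} (p : Walk ends A x x) → IsPath p → z ∈ˡ verts p → z ≡ x
    closed-path []             _          (here z≡x) = z≡x
    closed-path (step _ _ _ p) (x∉p ∷ _) _          = contradiction refl (All.lookup x∉p (last∈verts p))

    step-reduced : ∀ {x w y} f → f S.∈ A → Joins ends f x w →
            Σ (Walk ends A w y) (NonBacktracking ∘ edges) → Σ (Walk ends A x y) (NonBacktracking ∘ edges)
    step-reduced f f∈A j ([] , _) = step f f∈A j [] , [-]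
    step-reduced f f∈A j (step g g∈A j′ q , nb) with f ≟ g
    ... | no f≢g = step f f∈A j (step g g∈A j′ q) , f≢g ∷ nb
    ... | yes refl with Joins-back j j′
    ...   | refl = q , Linked.tail nb

    reduceʷ : ∀ {x y} → Walk ends A x y → Σ (Walk ends A x y) (NonBacktracking ∘ edges)
    reduceʷ []               = [] , []
    reduceʷ (step f f∈A j p) = step-reduced f f∈A j (reduceʷ p)

module _ (G : Graph) where
  open Graph G
  open Walks ends

  Joins⇒≢ : ∀ {e u w} → Joins ends e u w → u ≢ w
  Joins⇒≢ {e} (inj₁ p) refl = noLoop e (trans (cong proj₁ p) (sym (cong proj₂ p)))
  Joins⇒≢ {e} (inj₂ p) refl = noLoop e (trans (cong proj₁ p) (sym (cong proj₂ p)))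

  -- joinSet G a b and incident G u are, definitionally, the subsets decided by joins? a b and touches? u.
  joins? : ∀ a b e →
           Dec ((proj₁ (ends e) ≡ a × proj₂ (ends e) ≡ b) ⊎ (proj₁ (ends e) ≡ b × proj₂ (ends e) ≡ a))
  joins? a b e =
    (proj₁ (ends e) ≟ a ×-dec proj₂ (ends e) ≟ b) ⊎-dec (proj₁ (ends e) ≟ b ×-dec proj₂ (ends e) ≟ a)

  touches? : ∀ u e → Dec (proj₁ (ends e) ≡ u ⊎ proj₂ (ends e) ≡ u)
  touches? u e = proj₁ (ends e) ≟ u ⊎-dec proj₂ (ends e) ≟ u

  ∈-joinSet⁺ : ∀ {f a b} → Joins ends f a b → f S.∈ joinSet G a b
  ∈-joinSet⁺ {a = a} {b} j = ∈-decided⁺ (joins? a b) (Sum.map ,-injective ,-injective j)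

  ∈-joinSet⁻ : ∀ {f a b} → f S.∈ joinSet G a b → Joins ends f a b
  ∈-joinSet⁻ {a = a} {b} f∈ =
    Sum.map (Prod.uncurry (cong₂ _,_)) (Prod.uncurry (cong₂ _,_)) (∈-decided⁻ (joins? a b) f∈)

  joinSet-sym : ∀ a b → joinSet G a b ≡ joinSet G b a
  joinSet-sym a b = tabulate-cong λ e →
    ∨-comm (does (proj₁ (ends e) ≟ a ×-dec proj₂ (ends e) ≟ b))
           (does (proj₁ (ends e) ≟ b ×-dec proj₂ (ends e) ≟ a))

  ∈-incident⁺ : ∀ {f u w} → Joins ends f u w → f S.∈ incident G u
  ∈-incident⁺ {u = u} j = ∈-decided⁺ (touches? u) (Sum.map (cong proj₁) (cong proj₂) j)

  ∈-incident⁻ : ∀ {f u} → f S.∈ incident G u → ∃[ w ] Joins ends f w u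
  ∈-incident⁻ {f} {u} f∈ with ∈-decided⁻ (touches? u) f∈
  ... | inj₁ p₁≡u = proj₂ (ends f) , inj₂ (cong (_, proj₂ (ends f)) p₁≡u)
  ... | inj₂ p₂≡u = proj₁ (ends f) , inj₁ (cong (proj₁ (ends f) ,_) p₂≡u)

  revisit⇒HasCycle : ∀ {E x w y f} → f S.∈ E → Joins ends f x w → (p : Walk ends E w y) →
                     NonBacktracking (f ∷ edges p) → IsPath p → x ∈ˡ verts p → HasCycle G E
  revisit⇒HasCycle f∈E j []             _ _ (here refl) = contradiction refl (Joins⇒≢ j)
  revisit⇒HasCycle f∈E j (step _ _ _ _) _ _ (here refl) = contradiction refl (Joins⇒≢ j)
  revisit⇒HasCycle {x = x} {w} {f = f} f∈E j (step g g∈E j′ p) (f≢g ∷ _) (w∉p ∷ p!) (there x∈p) =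
    w , x , step g g∈E j′ q , w∉q ∷ IsPath-prefixʷ p x∈p p! , s≤s z≤n , f , f∈E , j , f∉q
    where
    q = prefixʷ p x∈p
    w∉q : All.All (w ≢_) (verts q)
    w∉q = All.tabulate (All.lookup w∉p ∘ verts-prefixʷ⊆ p x∈p)
    f∉q : ¬ (f ∈ˡ g ∷ edges q)
    f∉q (here f≡g)  = f≢g f≡g
    f∉q (there f∈q) = All.lookup w∉q (proj₂ (Joins-∈-verts q j f∈q)) refl

  module _ {E : Subset m} (acyclic : ¬ HasCycle G E) where

    NonBacktracking⇒IsPath : ∀ {x y} (p : Walk ends E x y) → NonBacktracking (edges p) → IsPath p
    NonBacktracking⇒IsPath []               _  = All.[] ∷ []
    NonBacktracking⇒IsPath (step f f∈E j p) nb = All.tabulate x∉p ∷ p!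
      where
      p! = NonBacktracking⇒IsPath p (Linked.tail nb)
      x∉p : ∀ {z} → z ∈ˡ verts p → _ ≢ z
      x∉p z∈p refl = acyclic (revisit⇒HasCycle f∈E j p nb p! z∈p)

    no-parallel : ∀ {f g a b} → f S.∈ E → g S.∈ E → g ≢ f → Joins ends f a b → Joins ends g a b → ⊥
    no-parallel {f} {g} {a} {b} f∈E g∈E g≢f jf jg =
      acyclic (a , b , step f f∈E jf [] , (Joins⇒≢ jf All.∷ All.[]) ∷ All.[] ∷ [] , s≤s z≤n ,
               g , g∈E , Joins-sym jg , g∉)
      where
      g∉ : ¬ (g ∈ˡ f ∷ [])
      g∉ (here g≡f) = g≢f g≡f

  module Tree (T : Sub G) (tree : IsTree G T) where
    open Sub T

    acyclic : ¬ HasCycle G E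
    acyclic = proj₂ (proj₂ (proj₂ tree))

    Joins⇒∈V : ∀ {e u w} → e S.∈ E → Joins ends e u w → u S.∈ V × w S.∈ V
    Joins⇒∈V {e} e∈E j with Joins-ends j (inj₁ refl)
    ... | inj₁ (refl , refl) = proj₁ tree e e∈E
    ... | inj₂ (refl , refl) = Prod.swap (proj₁ tree e e∈E)

    -- z lies in the component of T − e that contains a.
    OnSide : Fin m → Fin n → Fin n → Set
    OnSide e a z = Σ (Walk ends E z a) λ W → NonBacktracking (edges W ++ e ∷ [])

    OnSide-reverse : ∀ {e a z} (W : Walk ends E a z) → NonBacktracking (e ∷ edges W) → OnSide e a z
    OnSide-reverse {e} W nb = reverseʷ W , subst NonBacktracking edges≡ (Linked-reverse ≢-sym nb)
      where
      edges≡ : reverse (e ∷ edges W) ≡ edges (reverseʷ W) ++ e ∷ []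
      edges≡ = trans (unfold-reverse e (edges W)) (cong (_++ e ∷ []) (sym (edges-reverseʷ W)))

    sides : ∀ {e a b z} → e S.∈ E → Joins ends e a b → z S.∈ V → OnSide e a z ⊎ OnSide e b z
    sides {e} {a} {b} {z} e∈E j z∈V =
      classify (reduceʷ (proj₁ (proj₂ (proj₂ tree)) _ _ (proj₂ (Joins⇒∈V e∈E j)) z∈V))
      where
      classify : Σ (Walk ends E b z) (NonBacktracking ∘ edges) → OnSide e a z ⊎ OnSide e b z
      classify ([] , _) = inj₂ ([] , [-])
      classify (step g g∈E j′ W , nb) with e ≟ g
      ... | no e≢g = inj₂ (OnSide-reverse (step g g∈E j′ W) (e≢g ∷ nb))
      ... | yes refl with Joins-back j j′
      ...   | refl = inj₁ (OnSide-reverse W nb)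

    PathThrough : Fin n → Fin n → Fin n → Set
    PathThrough x y s = Σ (Walk ends E x y) λ P → IsPath P × s ∈ˡ verts P

    path-across : ∀ {e a b x y} → e S.∈ E → Joins ends e a b → OnSide e a x → OnSide e b y →
                  PathThrough x y a × PathThrough x y b
    path-across {e} e∈E j (Wx , nbx) (Wy , nby) =
      (P , P! , ∈-verts-++ʷʳ Wx (here refl)) ,
      (P , P! , ∈-verts-++ʷʳ Wx (there (first∈verts (reverseʷ Wy))))
      where
      P = Wx ++ʷ step e e∈E j (reverseʷ Wy)
      edges≡ : edges Wx ++ e ∷ reverse (edges Wy) ≡ edges P
      edges≡ = sym (trans (edges-++ʷ Wx _) (cong (λ es → edges Wx ++ e ∷ es) (edges-reverseʷ Wy)))
      P! : IsPath P
      P! = NonBacktracking⇒IsPath acyclic P (subst NonBacktracking edges≡ (Linked-++-meet (edges Wx) nbx nby⁻¹))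
        where
        nby⁻¹ : NonBacktracking (e ∷ reverse (edges Wy))
        nby⁻¹ = subst NonBacktracking (reverse-++ (edges Wy) (e ∷ [])) (Linked-reverse ≢-sym nby)

    module Steiner {R : Subset n} (leaves∈R : ∀ v → IsLeaf G T v → v S.∈ R) where

      another-edge : ∀ {f z w} → f S.∈ E → Joins ends f z w → z S.∉ R →
                     ∃[ g ] ∃[ z′ ] g S.∈ E × Joins ends g z′ z × g ≢ f
      another-edge {f} f∈E j z∉R
        with ∈∧∣p∣≢1⇒∃-∈-≢ (x∈p∩q⁺ (f∈E , ∈-incident⁺ j)) (z∉R ∘ leaves∈R _ ∘ (proj₁ (Joins⇒∈V f∈E j) ,_))
      ... | g , g∈ , g≢f with x∈p∩q⁻ E _ g∈
      ...   | g∈E , g∈incident with ∈-incident⁻ g∈incident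
      ...     | z′ , j′ = g , z′ , g∈E , j′ , g≢f

      terminal-on-side : ∀ {e a b} → e S.∈ E → Joins ends e a b → ∃[ x ] x S.∈ R × OnSide e a x
      terminal-on-side {e} {a} e∈E j = search n [] [-] refl
        where
        extend : ∀ {z} (W : Walk ends E z a) → NonBacktracking (edges W ++ e ∷ []) → z S.∉ R →
                 ∃[ z′ ] Σ (Walk ends E z′ a) λ W′ →
                   NonBacktracking (edges W′ ++ e ∷ []) × length (verts W′) ≡ suc (length (verts W))
        extend [] nb z∉R with another-edge e∈E j z∉R
        ... | g , z′ , g∈E , j′ , g≢e = z′ , step g g∈E j′ [] , g≢e ∷ [-] , refl
        extend (step f f∈E jf W) nb z∉R with another-edge f∈E jf z∉R
        ... | g , z′ , g∈E , j′ , g≢f = z′ , step g g∈E j′ (step f f∈E jf W) , g≢f ∷ nb , refl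

        -- Leaving each non-terminal, hence non-leaf, vertex by a fresh edge keeps the walk a path,
        -- so a terminal is reached within n steps.
        search : ∀ {z} fuel (W : Walk ends E z a) → NonBacktracking (edges W ++ e ∷ []) →
                 length (verts W) + fuel ≡ suc n → ∃[ x ] x S.∈ R × OnSide e a x
        search zero W nb len =
          contradiction (subst (_≤ n) (trans (sym (+-identityʳ _)) len)
                          (Unique⇒length≤ (NonBacktracking⇒IsPath acyclic W (Linked-++⁻ˡ (edges W) nb))))
                        1+n≰n
        search {z} (suc fuel) W nb len with z ∈? R
        ... | yes z∈R = z , z∈R , W , nb
        ... | no z∉R with extend W nb z∉R
        ...   | _ , W′ , nb′ , len′ =
          search fuel W′ nb′ (trans (cong (_+ fuel) len′) (trans (sym (+-suc _ fuel)) len))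

  IsCIST-reframe : ∀ {H H′ R k T} → (∀ i → Sub.E (T i) S.⊆ H′) → IsCIST G H R k T → IsCIST G H′ R k T
  IsCIST-reframe E⊆H′ (steiner , independent) =
    (λ i → let tree , _ , R⊆V , leaves∈R = steiner i in tree , E⊆H′ i , R⊆V , leaves∈R) , independent

  module _ (R : Subset n) where

    -- IsSimp G R S is, definitionally, ∀ u v → u ≢ v → SimpCount u v (kept G S u v).
    SimpCount : Fin n → Fin n → ℕ → Set
    SimpCount u v x =
      (mult G u v ≤ 1 → x ≡ mult G u v) ×
      (1 < mult G u v → u S.∈ R → v S.∈ R → 3 ≤ ∣ R ∣ → x ≡ 2) ×
      (1 < mult G u v → (¬ (u S.∈ R) ⊎ ¬ (v S.∈ R)) → x ≡ 1) ×
      (1 < mult G u v → u S.∈ R → v S.∈ R → ∣ R ∣ ≡ 2 → x ≡ mult G u v)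

    SimpCount-sym : ∀ {u v x} → SimpCount u v x → SimpCount v u x
    SimpCount-sym {u} {v} (s₁ , s₂ , s₃ , s₄) =
      (λ μ≤1 → trans (s₁ (subst (_≤ 1) μ≡ μ≤1)) (sym μ≡)) ,
      (λ 1<μ v∈R u∈R → s₂ (subst (1 <_) μ≡ 1<μ) u∈R v∈R) ,
      (λ 1<μ v∉R⊎u∉R → s₃ (subst (1 <_) μ≡ 1<μ) (Sum.swap v∉R⊎u∉R)) ,
      (λ 1<μ v∈R u∈R ∣R∣≡2 → trans (s₄ (subst (1 <_) μ≡ 1<μ) u∈R v∈R ∣R∣≡2) (sym μ≡))
      where
      μ≡ : mult G v u ≡ mult G u v
      μ≡ = cong ∣_∣ (joinSet-sym v u)

    simpCount : Fin n → Fin n → ℕ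
    simpCount u v with mult G u v ≤? 1 | u ∈? R | v ∈? R | ∣ R ∣ ≟ℕ 2
    ... | yes _ | _     | _     | _     = mult G u v
    ... | no _  | yes _ | yes _ | yes _ = mult G u v
    ... | no _  | yes _ | yes _ | no _  = 2
    ... | no _  | yes _ | no _  | _     = 1
    ... | no _  | no _  | _     | _     = 1

    simpCount-spec : ∀ u v → SimpCount u v (simpCount u v)
    simpCount-spec u v with mult G u v ≤? 1 | u ∈? R | v ∈? R | ∣ R ∣ ≟ℕ 2
    ... | yes μ≤1 | _       | _       | _ =
      (λ _ → refl) , (λ 1<μ → contradiction μ≤1 (<⇒≱ 1<μ)) ,
      (λ 1<μ → contradiction μ≤1 (<⇒≱ 1<μ)) , (λ _ _ _ _ → refl)
    ... | no μ≰1  | yes u∈R | yes v∈R | yes ∣R∣≡2 =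
      (λ μ≤1 → contradiction μ≤1 μ≰1) , (λ _ _ _ 3≤∣R∣ → contradiction ∣R∣≡2 (>⇒≢ 3≤∣R∣)) ,
      (λ _ → Sum.[ contradiction u∈R , contradiction v∈R ]) , (λ _ _ _ _ → refl)
    ... | no μ≰1  | yes u∈R | yes v∈R | no ∣R∣≢2 =
      (λ μ≤1 → contradiction μ≤1 μ≰1) , (λ _ _ _ _ → refl) ,
      (λ _ → Sum.[ contradiction u∈R , contradiction v∈R ]) , (λ _ _ _ ∣R∣≡2 → contradiction ∣R∣≡2 ∣R∣≢2)
    ... | no μ≰1  | yes _   | no v∉R  | _ =
      (λ μ≤1 → contradiction μ≤1 μ≰1) , (λ _ _ v∈R _ → contradiction v∈R v∉R) ,
      (λ _ _ → refl) , (λ _ _ v∈R _ → contradiction v∈R v∉R)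
    ... | no μ≰1  | no u∉R  | _       | _ =
      (λ μ≤1 → contradiction μ≤1 μ≰1) , (λ _ u∈R _ _ → contradiction u∈R u∉R) ,
      (λ _ _ → refl) , (λ _ u∈R _ _ → contradiction u∈R u∉R)

    simpCount≤mult : ∀ u v → simpCount u v ≤ mult G u v
    simpCount≤mult u v with mult G u v ≤? 1 | u ∈? R | v ∈? R | ∣ R ∣ ≟ℕ 2
    ... | yes _   | _     | _     | _     = ≤-refl
    ... | no _    | yes _ | yes _ | yes _ = ≤-refl
    ... | no μ≰1  | yes _ | yes _ | no _  = ≰⇒> μ≰1
    ... | no μ≰1  | yes _ | no _  | _     = <⇒≤ (≰⇒> μ≰1)
    ... | no μ≰1  | no _  | _     | _     = <⇒≤ (≰⇒> μ≰1)

    SimpCount⇒≡simpCount : 2 ≤ ∣ R ∣ → ∀ {u v x} → SimpCount u v x → x ≡ simpCount u v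
    SimpCount⇒≡simpCount 2≤∣R∣ {u} {v} (s₁ , s₂ , s₃ , s₄)
      with mult G u v ≤? 1 | u ∈? R | v ∈? R | ∣ R ∣ ≟ℕ 2
    ... | yes μ≤1 | _       | _       | _         = s₁ μ≤1
    ... | no μ≰1  | yes u∈R | yes v∈R | yes ∣R∣≡2 = s₄ (≰⇒> μ≰1) u∈R v∈R ∣R∣≡2
    ... | no μ≰1  | yes u∈R | yes v∈R | no ∣R∣≢2  = s₂ (≰⇒> μ≰1) u∈R v∈R (≤∧≢⇒< 2≤∣R∣ (≢-sym ∣R∣≢2))
    ... | no μ≰1  | yes _   | no v∉R  | _         = s₃ (≰⇒> μ≰1) (inj₂ v∉R)
    ... | no μ≰1  | no u∉R  | _       | _         = s₃ (≰⇒> μ≰1) (inj₁ u∉R)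

    simpCount-sym : 2 ≤ ∣ R ∣ → ∀ u v → simpCount u v ≡ simpCount v u
    simpCount-sym 2≤∣R∣ u v = SimpCount⇒≡simpCount 2≤∣R∣ (SimpCount-sym (simpCount-spec u v))

  module CIST {R : Subset n} {k : ℕ} {T : Fin k → Sub G} {H : Subset m} (cist : IsCIST G H R k T) where

    E : Fin k → Subset m
    E i = Sub.E (T i)

    module Tᵢ (i : Fin k) where
      open Tree (T i) (proj₁ (proj₁ cist i)) public
      open Steiner (proj₂ (proj₂ (proj₂ (proj₁ cist i)))) public
      R⊆V : R S.⊆ Sub.V (T i)
      R⊆V = proj₁ (proj₂ (proj₂ (proj₁ cist i)))

    no-common-inner-vertex : ∀ {i j x y s} → i ≢ j → x S.∈ R → y S.∈ R → s ≢ x → s ≢ y →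
                             Tᵢ.PathThrough i x y s → Tᵢ.PathThrough j x y s → ⊥
    no-common-inner-vertex {i} {j} {x} {y} {s} i≢j x∈R y∈R s≢x s≢y (P , P! , s∈P) (Q , Q! , s∈Q) =
      Sum.[ s≢x , s≢y ] (proj₂ (proj₂ cist x y x∈R y∈R x≢y i j i≢j P P! Q Q!) s s∈P s∈Q)
      where
      x≢y : x ≢ y
      x≢y refl = s≢x (closed-path P P! s∈P)

    parallel-at-nonterminal : ∀ {i j a b e₁ e₂} → i ≢ j → e₁ S.∈ E i → Joins ends e₁ a b →
                              e₂ S.∈ E j → Joins ends e₂ a b → a S.∉ R → ⊥
    parallel-at-nonterminal {i} {j} {a} {b} {e₁} {e₂} i≢j e₁∈E j₁ e₂∈E j₂ a∉R =
      separated (Tᵢ.terminal-on-side i e₁∈E j₁) (Tᵢ.terminal-on-side i e₁∈E (Joins-sym j₁))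
      where
      separated-in-both : ∀ {x y} → x S.∈ R → y S.∈ R → Tᵢ.OnSide i e₁ a x → Tᵢ.OnSide i e₁ b y →
        (Tᵢ.OnSide j e₂ a x × Tᵢ.OnSide j e₂ b y) ⊎ (Tᵢ.OnSide j e₂ b x × Tᵢ.OnSide j e₂ a y) → ⊥
      separated-in-both x∈R y∈R xa yb sides-j =
        no-common-inner-vertex i≢j x∈R y∈R (λ { refl → a∉R x∈R }) (λ { refl → a∉R y∈R })
          (proj₁ (Tᵢ.path-across i e₁∈E j₁ xa yb))
          (Sum.[ (λ (xa′ , yb′) → proj₁ (Tᵢ.path-across j e₂∈E j₂ xa′ yb′))
               , (λ (xb′ , ya′) → proj₂ (Tᵢ.path-across j e₂∈E (Joins-sym j₂) xb′ ya′)) ] sides-j)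

      separated : ∃[ x ] x S.∈ R × Tᵢ.OnSide i e₁ a x → ∃[ y ] y S.∈ R × Tᵢ.OnSide i e₁ b y → ⊥
      separated (x , x∈R , xa) (y , y∈R , yb)
        with Tᵢ.sides j e₂∈E j₂ (Tᵢ.R⊆V j x∈R) | Tᵢ.sides j e₂∈E j₂ (Tᵢ.R⊆V j y∈R)
      ... | inj₁ xa′ | inj₂ yb′ = separated-in-both x∈R y∈R xa yb (inj₁ (xa′ , yb′))
      ... | inj₂ xb′ | inj₁ ya′ = separated-in-both x∈R y∈R xa yb (inj₂ (xb′ , ya′))
      ... | inj₁ xa′ | inj₁ ya′ =
        let z , z∈R , zb′ = Tᵢ.terminal-on-side j e₂∈E (Joins-sym j₂) in
        Sum.[ (λ za → separated-in-both z∈R y∈R za yb (inj₂ (zb′ , ya′)))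
            , (λ zb → separated-in-both x∈R z∈R xa zb (inj₁ (xa′ , zb′))) ] (Tᵢ.sides i e₁∈E j₁ (Tᵢ.R⊆V i z∈R))
      ... | inj₂ xb′ | inj₂ yb′ =
        let z , z∈R , za′ = Tᵢ.terminal-on-side j e₂∈E j₂ in
        Sum.[ (λ za → separated-in-both z∈R y∈R za yb (inj₁ (za′ , yb′)))
            , (λ zb → separated-in-both x∈R z∈R xa zb (inj₂ (xb′ , za′))) ] (Tᵢ.sides i e₁∈E j₁ (Tᵢ.R⊆V i z∈R))

    same-side-in-two-trees : ∀ {t t′ f f′ a b w} → t ≢ t′ → f S.∈ E t → Joins ends f a b →
      f′ S.∈ E t′ → Joins ends f′ a b → w S.∈ R → b S.∈ R → a ≢ w →
      Tᵢ.OnSide t f a w → Tᵢ.OnSide t′ f′ a w → ⊥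
    same-side-in-two-trees {t} {t′} t≢t′ f∈E jf f′∈E jf′ w∈R b∈R a≢w wa wa′ =
      no-common-inner-vertex t≢t′ w∈R b∈R a≢w (Joins⇒≢ jf)
        (proj₁ (Tᵢ.path-across t f∈E jf wa ([] , [-])))
        (proj₁ (Tᵢ.path-across t′ f′∈E jf′ wa′ ([] , [-])))

    three-parallel-between-terminals : ∀ {i₁ i₂ i₃ f₁ f₂ f₃ a b} → 3 ≤ ∣ R ∣ → a S.∈ R → b S.∈ R →
      i₁ ≢ i₂ → i₁ ≢ i₃ → i₂ ≢ i₃ → f₁ S.∈ E i₁ → Joins ends f₁ a b → f₂ S.∈ E i₂ → Joins ends f₂ a b →
      f₃ S.∈ E i₃ → Joins ends f₃ a b → ⊥
    three-parallel-between-terminals {i₁} {i₂} {i₃} {f₁} {f₂} {f₃} {a} {b}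
                                     3≤∣R∣ a∈R b∈R i₁≢i₂ i₁≢i₃ i₂≢i₃ f₁∈ j₁ f₂∈ j₂ f₃∈ j₃
      with ∃-∈-≢₂ a b 3≤∣R∣
    ... | w , w∈R , w≢a , w≢b =
      two-agree (Tᵢ.sides i₁ f₁∈ j₁ (Tᵢ.R⊆V i₁ w∈R)) (Tᵢ.sides i₂ f₂∈ j₂ (Tᵢ.R⊆V i₂ w∈R))
                (Tᵢ.sides i₃ f₃∈ j₃ (Tᵢ.R⊆V i₃ w∈R))
      where
      on-a : ∀ {t t′ f f′} → t ≢ t′ → f S.∈ E t → Joins ends f a b → f′ S.∈ E t′ → Joins ends f′ a b →
             Tᵢ.OnSide t f a w → Tᵢ.OnSide t′ f′ a w → ⊥
      on-a t≢t′ f∈ jf f′∈ jf′ = same-side-in-two-trees t≢t′ f∈ jf f′∈ jf′ w∈R b∈R (≢-sym w≢a)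

      on-b : ∀ {t t′ f f′} → t ≢ t′ → f S.∈ E t → Joins ends f a b → f′ S.∈ E t′ → Joins ends f′ a b →
             Tᵢ.OnSide t f b w → Tᵢ.OnSide t′ f′ b w → ⊥
      on-b t≢t′ f∈ jf f′∈ jf′ =
        same-side-in-two-trees t≢t′ f∈ (Joins-sym jf) f′∈ (Joins-sym jf′) w∈R a∈R (≢-sym w≢b)

      two-agree : Tᵢ.OnSide i₁ f₁ a w ⊎ Tᵢ.OnSide i₁ f₁ b w → Tᵢ.OnSide i₂ f₂ a w ⊎ Tᵢ.OnSide i₂ f₂ b w →
                  Tᵢ.OnSide i₃ f₃ a w ⊎ Tᵢ.OnSide i₃ f₃ b w → ⊥
      two-agree (inj₁ w₁) (inj₁ w₂) _         = on-a i₁≢i₂ f₁∈ j₁ f₂∈ j₂ w₁ w₂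
      two-agree (inj₂ w₁) (inj₂ w₂) _         = on-b i₁≢i₂ f₁∈ j₁ f₂∈ j₂ w₁ w₂
      two-agree (inj₁ w₁) (inj₂ _)  (inj₁ w₃) = on-a i₁≢i₃ f₁∈ j₁ f₃∈ j₃ w₁ w₃
      two-agree (inj₁ _)  (inj₂ w₂) (inj₂ w₃) = on-b i₂≢i₃ f₂∈ j₂ f₃∈ j₃ w₂ w₃
      two-agree (inj₂ _)  (inj₁ w₂) (inj₁ w₃) = on-a i₂≢i₃ f₂∈ j₂ f₃∈ j₃ w₂ w₃
      two-agree (inj₂ w₁) (inj₁ _)  (inj₂ w₃) = on-b i₁≢i₃ f₁∈ j₁ f₃∈ j₃ w₁ w₃

    in-some-tree? : ∀ f → Dec (∃[ i ] f S.∈ E i)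
    in-some-tree? f = any? λ i → f ∈? E i

    U : Subset m
    U = tabulate (does ∘ in-some-tree?)

    ∈U⁺ : ∀ {f i} → f S.∈ E i → f S.∈ U
    ∈U⁺ {i = i} f∈E = ∈-decided⁺ in-some-tree? (i , f∈E)

    ∈U∩joinSet⁻ : ∀ {f a b} → f S.∈ U ∩ joinSet G a b → ∃[ i ] f S.∈ E i × Joins ends f a b
    ∈U∩joinSet⁻ f∈ with x∈p∩q⁻ U _ f∈
    ... | f∈U , f∈J with ∈-decided⁻ in-some-tree? f∈U
    ...   | i , f∈E = i , f∈E , ∈-joinSet⁻ f∈J

    ∣U∩joinSet∣≤1 : ∀ {a b} → a S.∉ R ⊎ b S.∉ R → ∣ U ∩ joinSet G a b ∣ ≤ 1
    ∣U∩joinSet∣≤1 {a} {b} nonterminal = ∣p∣≤1 λ f∈ g∈ → two-edges (∈U∩joinSet⁻ f∈) (∈U∩joinSet⁻ g∈)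
      where
      two-edges : ∀ {f g} → ∃[ i ] f S.∈ E i × Joins ends f a b → ∃[ j ] g S.∈ E j × Joins ends g a b →
                  f ≢ g → ⊥
      two-edges (i , f∈ , jf) (j , g∈ , jg) f≢g with i ≟ j
      ... | yes refl = no-parallel (Tᵢ.acyclic i) f∈ g∈ (≢-sym f≢g) jf jg
      ... | no i≢j   = Sum.[ parallel-at-nonterminal i≢j f∈ jf g∈ jg
                           , parallel-at-nonterminal i≢j f∈ (Joins-sym jf) g∈ (Joins-sym jg) ] nonterminal

    ∣U∩joinSet∣≤2 : ∀ {a b} → 3 ≤ ∣ R ∣ → a S.∈ R → b S.∈ R → ∣ U ∩ joinSet G a b ∣ ≤ 2
    ∣U∩joinSet∣≤2 {a} {b} 3≤∣R∣ a∈R b∈R =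
      ∣p∣≤2 λ f∈ g∈ h∈ → three-edges (∈U∩joinSet⁻ f∈) (∈U∩joinSet⁻ g∈) (∈U∩joinSet⁻ h∈)
      where
      three-edges : ∀ {f g h} → ∃[ i ] f S.∈ E i × Joins ends f a b → ∃[ j ] g S.∈ E j × Joins ends g a b →
                    ∃[ l ] h S.∈ E l × Joins ends h a b → f ≢ g → f ≢ h → g ≢ h → ⊥
      three-edges (i , f∈ , jf) (j , g∈ , jg) (l , h∈ , jh) f≢g f≢h g≢h with i ≟ j | i ≟ l | j ≟ l
      ... | yes refl | _        | _        = no-parallel (Tᵢ.acyclic i) f∈ g∈ (≢-sym f≢g) jf jg
      ... | no _     | yes refl | _        = no-parallel (Tᵢ.acyclic i) f∈ h∈ (≢-sym f≢h) jf jh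
      ... | no _     | no _     | yes refl = no-parallel (Tᵢ.acyclic j) g∈ h∈ (≢-sym g≢h) jg jh
      ... | no i≢j   | no i≢l   | no j≢l   =
        three-parallel-between-terminals 3≤∣R∣ a∈R b∈R i≢j i≢l j≢l f∈ jf g∈ jg h∈ jh

    ∣U∩joinSet∣≤simpCount : 2 ≤ ∣ R ∣ → ∀ a b → ∣ U ∩ joinSet G a b ∣ ≤ simpCount R a b
    ∣U∩joinSet∣≤simpCount 2≤∣R∣ a b with mult G a b ≤? 1 | a ∈? R | b ∈? R | ∣ R ∣ ≟ℕ 2
    ... | yes _ | _       | _       | _       = ∣p∩q∣≤∣q∣ U _
    ... | no _  | yes _   | yes _   | yes _   = ∣p∩q∣≤∣q∣ U _
    ... | no _  | yes a∈R | yes b∈R | no ∣R∣≢2 = ∣U∩joinSet∣≤2 (≤∧≢⇒< 2≤∣R∣ (≢-sym ∣R∣≢2)) a∈R b∈R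
    ... | no _  | yes _   | no b∉R  | _       = ∣U∩joinSet∣≤1 (inj₂ b∉R)
    ... | no _  | no a∉R  | _       | _       = ∣U∩joinSet∣≤1 (inj₁ a∉R)

  module Simplification {R : Subset n} {k : ℕ} {T : Fin k → Sub G} {H : Subset m}
                        (cist : IsCIST G H R k T) (2≤∣R∣ : 2 ≤ ∣ R ∣) where
    open CIST cist

    keep : Fin n → Fin n → Subset m
    keep a b = fill (simpCount R a b ∸ ∣ U ∩ joinSet G a b ∣) (U ∩ joinSet G a b) (joinSet G a b)

    keep-sym : ∀ a b → keep a b ≡ keep b a
    keep-sym a b = cong₂ (λ c J → fill (c ∸ ∣ U ∩ J ∣) (U ∩ J) J) (simpCount-sym R 2≤∣R∣ a b) (joinSet-sym a b)

    keep⊆joinSet : ∀ a b → keep a b S.⊆ joinSet G a b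
    keep⊆joinSet a b = fill-⊆ _ (p∩q⊆q U _)

    ∣keep∣ : ∀ a b → ∣ keep a b ∣ ≡ simpCount R a b
    ∣keep∣ a b = trans (∣fill∣ _ (p∩q⊆q U _) (≤-trans (≤-reflexive U≤c) (simpCount≤mult R a b))) U≤c
      where
      U≤c : ∣ U ∩ joinSet G a b ∣ + (simpCount R a b ∸ ∣ U ∩ joinSet G a b ∣) ≡ simpCount R a b
      U≤c = m+[n∸m]≡n (∣U∩joinSet∣≤simpCount 2≤∣R∣ a b)

    keep? : ∀ f → Dec (f S.∈ keep (proj₁ (ends f)) (proj₂ (ends f)))
    keep? f = f ∈? keep (proj₁ (ends f)) (proj₂ (ends f))

    S : Subset m
    S = tabulate (does ∘ keep?)

    keep-ends : ∀ {f a b} → Joins ends f a b → keep (proj₁ (ends f)) (proj₂ (ends f)) ≡ keep a b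
    keep-ends (inj₁ ends≡) = cong (Prod.uncurry keep) ends≡
    keep-ends (inj₂ ends≡) = trans (cong (Prod.uncurry keep) ends≡) (keep-sym _ _)

    ∈S⁺ : ∀ {f a b} → Joins ends f a b → f S.∈ keep a b → f S.∈ S
    ∈S⁺ j f∈ = ∈-decided⁺ keep? (subst (_ S.∈_) (sym (keep-ends j)) f∈)

    ∈S⁻ : ∀ {f a b} → Joins ends f a b → f S.∈ S → f S.∈ keep a b
    ∈S⁻ j f∈ = subst (_ S.∈_) (keep-ends j) (∈-decided⁻ keep? f∈)

    S∩joinSet≡keep : ∀ a b → S ∩ joinSet G a b ≡ keep a b
    S∩joinSet≡keep a b = ⊆-antisym
      (λ f∈ → let f∈S , f∈J = x∈p∩q⁻ S _ f∈ in ∈S⁻ (∈-joinSet⁻ f∈J) f∈S)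
      (λ f∈ → let f∈J = keep⊆joinSet a b f∈ in x∈p∩q⁺ (∈S⁺ (∈-joinSet⁻ f∈J) f∈ , f∈J))

    simp : IsSimp G R S
    simp u v _ =
      subst (SimpCount R u v) (sym (trans (cong ∣_∣ (S∩joinSet≡keep u v)) (∣keep∣ u v))) (simpCount-spec R u v)

    trees⊆S : ∀ i → E i S.⊆ S
    trees⊆S i f∈E =
      ∈S⁺ (inj₁ refl) (⊆-fill _ (U ∩ joinSet G _ _) _ (x∈p∩q⁺ (∈U⁺ f∈E , ∈-joinSet⁺ (inj₁ refl))))

proposition3p6 : (G : Graph) → (R : Subset (Graph.n G)) → 2 ≤ ∣ R ∣ →
    (k : ℕ) → (T : Fin k → Sub G) →
    IsCIST G ⊤ R k T ⇔ Σ (Subset (Graph.m G)) (λ S → IsSimp G R S × IsCIST G S R k T)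
proposition3p6 G R 2≤∣R∣ k T = mk⇔ simplify (λ (_ , _ , cist) → IsCIST-reframe G (λ _ _ → ∈⊤) cist)
  where
  simplify : IsCIST G ⊤ R k T → Σ (Subset (Graph.m G)) (λ S → IsSimp G R S × IsCIST G S R k T)
  simplify cist = S , simp , IsCIST-reframe G trees⊆S cist
    where open Simplification G cist 2≤∣R∣
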